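{- Let $P$ be a linear program which is either a maximisation LP of the form $\max\{c^\top x : Ax \le b,\ x \ge 0\}$ with $c \in \mathbb{R}^n$, $b \in \mathbb{R}^m$, $A \in \mathbb{R}^{m\times n}$, or a minimisation LP of the form $\min\{v^\top x : Mx \ge u,\ x \ge 0\}$ with $v \in \mathbb{R}^n$, $u \in \mathbb{R}^m$, $M \in \mathbb{R}^{m \times n}$. Let $\overline{P}$ denote its complement (defined below). Then $\mathrm{Opt}(P) > 1$ if and only if $\mathrm{Opt}(\overline{P}) > 1$, in which case \[ \frac{1}{\mathrm{Opt}(P)} + \frac{1}{\mathrm{Opt}(\overline{P})} = 1. \]
   Context: For an LP $R$, $\mathrm{Opt}(R)$ denotes its optimal value (when it exists, i.e. when $R$ is feasible and bounded). The complement of the maximisation LP $P=\max\{c^\top x : Ax \le b,\ x\ge 0\}$ is the minimisation LP $\overline{P} = \min\{c^\top x : (b c^\top - A)x \ge b,\ x \ge 0\}$. The complement of the minimisation LP $Q = \min\{v^\top x : Mx \ge u,\ x \ge 0\}$ is the maximisation LP $\overline{Q} = \max\{v^\top x : (u v^\top - M)x \le u,\ x \ge 0\}$. -}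

module Defs where

open import Level using (0ℓ)
open import Data.Nat using (ℕ; zero; suc)
open import Data.Fin using (Fin; zero; suc)
open import Data.Product using (Σ; _×_; ∃)
open import Relation.Binary.PropositionalEquality using (_≡_; _≢_)
open import Relation.Binary.Structures using (IsTotalOrder)
open import Algebra.Structures using (IsCommutativeRing)

-- The real numbers ℝ are
-- an instance; the stdlib has no real numbers, so we state the result for
-- every ordered field.  Inverse is a total function, meaningful on nonzero
-- elements (as in Lean/Mathlib: 0⁻¹ is unconstrained).
record OrderedField : Set₁ where
  infixl 6 _+_
  infixl 7 _*_
  infix 4 _≤_ _<_
  field
    Carrier : Set
    _+_ _*_ : Carrier → Carrier → Carrier
    -_ : Carrier → Carrier
    _⁻¹ : Carrier → Carrier
    0# 1# : Carrier
    _≤_ : Carrier → Carrier → Set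
    isCommutativeRing : IsCommutativeRing _≡_ _+_ _*_ -_ 0# 1#
    isTotalOrder : IsTotalOrder _≡_ _≤_
    0≢1 : 0# ≢ 1#
    ⁻¹-inverse : ∀ x → x ≢ 0# → x * (x ⁻¹) ≡ 1#
    +-mono-≤ : ∀ x y z → x ≤ y → x + z ≤ y + z
    *-nonneg : ∀ x y → 0# ≤ x → 0# ≤ y → 0# ≤ x * y

  _<_ : Carrier → Carrier → Set
  x < y = (x ≤ y) × (x ≢ y)

  _-_ : Carrier → Carrier → Carrier
  x - y = x + (- y)

module LinearPrograms (F : OrderedField) where
  open OrderedField F

  sumF : (n : ℕ) → (Fin n → Carrier) → Carrier
  sumF zero f = 0#
  sumF (suc n) f = f zero + sumF n (λ j → f (suc j))

  dot : {n : ℕ} → (Fin n → Carrier) → (Fin n → Carrier) → Carrier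
  dot {n} u x = sumF n (λ j → u j * x j)

  data Sense : Set where
    maximise minimise : Sense

  record LP : Set where
    constructor mkLP
    field
      sense : Sense
      m n : ℕ
      obj : Fin n → Carrier
      mat : Fin m → Fin n → Carrier
      rhs : Fin m → Carrier

  open LP public

  Feasible : (R : LP) → (Fin (n R) → Carrier) → Set
  Feasible (mkLP maximise m n c A b) x =
    (∀ j → 0# ≤ x j) × (∀ i → dot (A i) x ≤ b i)
  Feasible (mkLP minimise m n c A b) x =
    (∀ j → 0# ≤ x j) × (∀ i → b i ≤ dot (A i) x)

  IsOpt : LP → Carrier → Set
  IsOpt R@(mkLP maximise m n c A b) t =
    (Σ (Fin n → Carrier) λ x → Feasible R x × dot c x ≡ t) ×
    (∀ y → Feasible R y → dot c y ≤ t)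
  IsOpt R@(mkLP minimise m n c A b) t =
    (Σ (Fin n → Carrier) λ x → Feasible R x × dot c x ≡ t) ×
    (∀ y → Feasible R y → t ≤ dot c y)

  flip : Sense → Sense
  flip maximise = minimise
  flip minimise = maximise

  complement : LP → LP
  complement (mkLP s m n c A b) =
    mkLP (flip s) m n c (λ i j → (b i * c j) - A i j) b

  OptGt1 : LP → Set
  OptGt1 R = ∃ λ t → IsOpt R t × 1# < t

{-# OPTIONS --safe #-}
module Submission where

open import Level using (0ℓ)
open import Data.Nat as ℕ using (ℕ; zero; suc; _∸_)
open import Data.Nat.Properties using (≤-total; m≤n⇒m∸n≡0; m∸n+n≡m)
open import Data.Fin using (Fin; zero; suc)
open import Data.Product using (_×_; _,_; proj₁; proj₂; ∃)
import Data.Product.Properties as Product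
open import Data.Sum using (inj₁; inj₂)
open import Data.Maybe using (Maybe; just; nothing)
open import Data.Empty using (⊥-elim)
open import Relation.Nullary using (yes; no)
open import Relation.Binary.PropositionalEquality
  using (_≡_; _≢_; cong; cong₂; subst; subst₂; ≢-sym; module ≡-Reasoning)
open import Relation.Binary.Structures using (IsTotalOrder)
open import Algebra.Bundles using (CommutativeRing; RawRing)
open import Algebra.Solver.Ring.AlmostCommutativeRing
  using (fromCommutativeRing; _-Raw-AlmostCommutative⟶_)
import Algebra.Solver.Ring as RingSolver
open import Defs

-- If x is optimal for P = max{cᵀx : Ax ≤ b} with value t > 1, then x/(t-1) is feasible
-- for the complement with value t/(t-1).  Conversely, if y is feasible for the complement
-- with value σ, then for some α > 0 with β = 1 - α(σ-1) ≥ 0 the point αy + βx is feasible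
-- for P, and cᵀ(αy + βx) ≤ t unwinds to σ ≥ t/(t-1).  Hence Opt(P̄) = t/(t-1), the
-- conjugate exponent of t, and 1/t + (t-1)/t = 1.  The minimisation case is the same
-- argument with max and min exchanged, since the rows of P are b cᵀ minus those of P̄.

-- The ring solver needs coefficients with (weakly) decidable equality, which the carrier
-- of an ordered field lacks; we use integers, coded as differences of naturals.
module IntegerCoefficients {c ℓ} (R : CommutativeRing c ℓ) where
  open CommutativeRing R
  open import Algebra.Properties.Ring ring using (x[y-z]≈xy-xz; [y-z]x≈yx-zx)
  open import Algebra.Properties.AbelianGroup +-abelianGroup
    using (ε⁻¹≈ε; ⁻¹-∙-comm; ⁻¹-anti-homo‿-)
  open import Algebra.Properties.CommutativeSemigroup +-commutativeSemigroup
    using (interchange)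
  import Algebra.Properties.Semiring.Mult.TCOptimised semiring as Mult
  open import Relation.Binary.Reasoning.Setoid setoid

  private
    ι : ℕ → Carrier
    ι n = n Mult.× 1#

    ι-+ : ∀ m n → ι (m ℕ.+ n) ≈ ι m + ι n
    ι-+ = Mult.×-homo-+ 1#

    ι-* : ∀ m n → ι (m ℕ.* n) ≈ ι m * ι n
    ι-* = Mult.×1-homo-*

    +-minus-interchange : ∀ a b x y → (a + b) - (x + y) ≈ (a - x) + (b - y)
    +-minus-interchange a b x y = begin
      (a + b) + - (x + y)    ≈⟨ +-congˡ (⁻¹-∙-comm x y) ⟨
      (a + b) + (- x + - y)  ≈⟨ interchange a b (- x) (- y) ⟩
      (a - x) + (b - y)      ∎

    minus-minus : ∀ a b x y → (a - b) - (x - y) ≈ (a + y) - (x + b)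
    minus-minus a b x y = begin
      (a - b) + - (x - y)  ≈⟨ +-congˡ (⁻¹-anti-homo‿- x y) ⟩
      (a - b) + (y - x)    ≈⟨ +-minus-interchange a y b x ⟨
      (a + y) - (b + x)    ≈⟨ +-congˡ (-‿cong (+-comm b x)) ⟩
      (a + y) - (x + b)    ∎

    ι-shift : ∀ p n k → ι (p ℕ.+ k) - ι (n ℕ.+ k) ≈ ι p - ι n
    ι-shift p n k = begin
      ι (p ℕ.+ k) - ι (n ℕ.+ k)    ≈⟨ +-cong (ι-+ p k) (-‿cong (ι-+ n k)) ⟩
      (ι p + ι k) - (ι n + ι k)    ≈⟨ +-minus-interchange (ι p) (ι k) (ι n) (ι k) ⟩
      (ι p - ι n) + (ι k - ι k)    ≈⟨ +-congˡ (-‿inverseʳ (ι k)) ⟩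
      (ι p - ι n) + 0#             ≈⟨ +-identityʳ (ι p - ι n) ⟩
      ι p - ι n                    ∎

    -- A pair (p , n) codes the integer p - n; the clause for n = 0 makes the
    -- codes of 0 and 1 denote 0# and 1# on the nose.
    ⟦_⟧ : ℕ × ℕ → Carrier
    ⟦ p , zero ⟧  = ι p
    ⟦ p , suc n ⟧ = ι p - ι (suc n)

    ⟦⟧-difference : ∀ p n → ⟦ p , n ⟧ ≈ ι p - ι n
    ⟦⟧-difference p zero    = sym (trans (+-congˡ ε⁻¹≈ε) (+-identityʳ (ι p)))
    ⟦⟧-difference p (suc n) = refl

    -- Canonical codes have a zero component, so equal integers get equal codes.
    canonical : ℕ → ℕ → ℕ × ℕ
    canonical p n = (p ∸ n , n ∸ p)

    canonical-sound : ∀ p n → ⟦ canonical p n ⟧ ≈ ι p - ι n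
    canonical-sound p n with ≤-total n p
    ... | inj₁ n≤p = begin
      ⟦ p ∸ n , n ∸ p ⟧      ≡⟨ cong (λ k → ⟦ p ∸ n , k ⟧) (m≤n⇒m∸n≡0 n≤p) ⟩
      ι (p ∸ n)              ≈⟨ ⟦⟧-difference (p ∸ n) 0 ⟩
      ι (p ∸ n) - ι 0        ≈⟨ ι-shift (p ∸ n) 0 n ⟨
      ι (p ∸ n ℕ.+ n) - ι n  ≡⟨ cong (λ k → ι k - ι n) (m∸n+n≡m n≤p) ⟩
      ι p - ι n              ∎
    ... | inj₂ p≤n = begin
      ⟦ p ∸ n , n ∸ p ⟧      ≡⟨ cong (λ k → ⟦ k , n ∸ p ⟧) (m≤n⇒m∸n≡0 p≤n) ⟩
      ⟦ 0 , n ∸ p ⟧          ≈⟨ ⟦⟧-difference 0 (n ∸ p) ⟩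
      ι 0 - ι (n ∸ p)        ≈⟨ ι-shift 0 (n ∸ p) p ⟨
      ι p - ι (n ∸ p ℕ.+ p)  ≡⟨ cong (λ k → ι p - ι k) (m∸n+n≡m p≤n) ⟩
      ι p - ι n              ∎

    ℤ-rawRing : RawRing 0ℓ 0ℓ
    ℤ-rawRing = record
      { Carrier = ℕ × ℕ
      ; _≈_     = _≡_
      ; _+_     = λ { (p , n) (p′ , n′) → canonical (p ℕ.+ p′) (n ℕ.+ n′) }
      ; _*_     = λ { (p , n) (p′ , n′) →
                    canonical (p ℕ.* p′ ℕ.+ n ℕ.* n′) (p ℕ.* n′ ℕ.+ n ℕ.* p′) }
      ; -_      = λ { (p , n) → (n , p) }
      ; 0#      = (0 , 0)
      ; 1#      = (1 , 0)
      }

    +-homo : ∀ x y → ⟦ RawRing._+_ ℤ-rawRing x y ⟧ ≈ ⟦ x ⟧ + ⟦ y ⟧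
    +-homo (p , n) (p′ , n′) = begin
      ⟦ canonical (p ℕ.+ p′) (n ℕ.+ n′) ⟧
        ≈⟨ canonical-sound (p ℕ.+ p′) (n ℕ.+ n′) ⟩
      ι (p ℕ.+ p′) - ι (n ℕ.+ n′)
        ≈⟨ +-cong (ι-+ p p′) (-‿cong (ι-+ n n′)) ⟩
      (ι p + ι p′) - (ι n + ι n′)
        ≈⟨ +-minus-interchange (ι p) (ι p′) (ι n) (ι n′) ⟩
      (ι p - ι n) + (ι p′ - ι n′)
        ≈⟨ +-cong (⟦⟧-difference p n) (⟦⟧-difference p′ n′) ⟨
      ⟦ p , n ⟧ + ⟦ p′ , n′ ⟧ ∎

    *-homo : ∀ x y → ⟦ RawRing._*_ ℤ-rawRing x y ⟧ ≈ ⟦ x ⟧ * ⟦ y ⟧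
    *-homo (p , n) (p′ , n′) = begin
      ⟦ canonical p* n* ⟧                        ≈⟨ canonical-sound p* n* ⟩
      ι (p ℕ.* p′ ℕ.+ n ℕ.* n′) - ι (p ℕ.* n′ ℕ.+ n ℕ.* p′)
        ≈⟨ +-cong (ι-*+* p p′ n n′) (-‿cong (ι-*+* p n′ n p′)) ⟩
      (P * P′ + N * N′) - (P * N′ + N * P′)
        ≈⟨ minus-minus (P * P′) (N * P′) (P * N′) (N * N′) ⟨
      (P * P′ - N * P′) - (P * N′ - N * N′)
        ≈⟨ +-cong ([y-z]x≈yx-zx P′ P N) (-‿cong ([y-z]x≈yx-zx N′ P N)) ⟨
      (P - N) * P′ - (P - N) * N′
        ≈⟨ x[y-z]≈xy-xz (P - N) P′ N′ ⟨
      (P - N) * (P′ - N′)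
        ≈⟨ *-cong (⟦⟧-difference p n) (⟦⟧-difference p′ n′) ⟨
      ⟦ p , n ⟧ * ⟦ p′ , n′ ⟧ ∎
      where
      p* = p ℕ.* p′ ℕ.+ n ℕ.* n′
      n* = p ℕ.* n′ ℕ.+ n ℕ.* p′
      P = ι p; N = ι n; P′ = ι p′; N′ = ι n′
      ι-*+* : ∀ a b c d → ι (a ℕ.* b ℕ.+ c ℕ.* d) ≈ ι a * ι b + ι c * ι d
      ι-*+* a b c d = trans (ι-+ (a ℕ.* b) (c ℕ.* d)) (+-cong (ι-* a b) (ι-* c d))

    -‿homo : ∀ x → ⟦ RawRing.-_ ℤ-rawRing x ⟧ ≈ - ⟦ x ⟧
    -‿homo (p , n) = begin
      ⟦ n , p ⟧        ≈⟨ ⟦⟧-difference n p ⟩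
      ι n - ι p        ≈⟨ ⁻¹-anti-homo‿- (ι p) (ι n) ⟨
      - (ι p - ι n)    ≈⟨ -‿cong (⟦⟧-difference p n) ⟨
      - ⟦ p , n ⟧      ∎

    morphism : ℤ-rawRing -Raw-AlmostCommutative⟶ fromCommutativeRing R
    morphism = record
      { ⟦_⟧    = ⟦_⟧
      ; +-homo = +-homo
      ; *-homo = *-homo
      ; -‿homo = -‿homo
      ; 0-homo = refl
      ; 1-homo = refl
      }

    coeff≟ : ∀ x y → Maybe (⟦ x ⟧ ≈ ⟦ y ⟧)
    coeff≟ x y with Product.≡-dec ℕ._≟_ ℕ._≟_ x y
    ... | yes x≡y = just (reflexive (cong ⟦_⟧ x≡y))
    ... | no _    = nothing

  open RingSolver ℤ-rawRing (fromCommutativeRing R) morphism coeff≟ public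
    using (Polynomial; con; _:+_; _:*_; :-_; _:-_; _:=_; solve)

  :0 :1 : ∀ {k} → Polynomial k
  :0 = con (0 , 0)
  :1 = con (1 , 0)

module _ (F : OrderedField) where
  open import Relation.Binary.PropositionalEquality using (refl; sym; trans)
  open OrderedField F
  open LinearPrograms F

  private
    commutativeRing : CommutativeRing 0ℓ 0ℓ
    commutativeRing = record { isCommutativeRing = isCommutativeRing }

    module ≤ = IsTotalOrder isTotalOrder

  open CommutativeRing commutativeRing
    using (+-identityˡ; -‿inverseʳ; *-identityˡ; *-identityʳ; *-assoc; *-comm; zeroʳ)
  open IntegerCoefficients commutativeRing
  open ≡-Reasoning

  -- _-_ has no fixity declaration, so it binds tighter than _+_ and _*_: a - b * c
  -- would mean (a - b) * c.  Hence the parentheses around products in differences.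

  +-vanish : ∀ {u} x k → u ≡ 1# → x + k * (u - 1#) ≡ x
  +-vanish x k refl = solve 2 (λ x k → x :+ k :* (:1 :- :1) := x) refl x k

  x≤y⇒0≤y-x : ∀ {x y} → x ≤ y → 0# ≤ y - x
  x≤y⇒0≤y-x {x} {y} x≤y = subst (_≤ y - x) (-‿inverseʳ x) (+-mono-≤ x y (- x) x≤y)

  0≤y-x⇒x≤y : ∀ {x y} → 0# ≤ y - x → x ≤ y
  0≤y-x⇒x≤y {x} {y} 0≤y-x =
    subst₂ _≤_ (+-identityˡ x) (solve 2 (λ x y → (y :- x) :+ x := y) refl x y)
      (+-mono-≤ 0# (y - x) x 0≤y-x)

  ≤-by-difference : ∀ {x y d} → y - x ≡ d → 0# ≤ d → x ≤ y
  ≤-by-difference refl = 0≤y-x⇒x≤y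

  x<y⇒0<y-x : ∀ {x y} → x < y → 0# < y - x
  x<y⇒0<y-x {x} {y} (x≤y , x≢y) = x≤y⇒0≤y-x x≤y , λ 0≡y-x → x≢y (begin
    x            ≡⟨ +-identityˡ x ⟨
    0# + x       ≡⟨ cong (_+ x) 0≡y-x ⟩
    (y - x) + x  ≡⟨ solve 2 (λ x y → (y :- x) :+ x := y) refl x y ⟩
    y            ∎)

  0<y-x⇒x<y : ∀ {x y} → 0# < y - x → x < y
  0<y-x⇒x<y (0≤y-x , 0≢y-x) = 0≤y-x⇒x≤y 0≤y-x , λ { refl → 0≢y-x (sym (-‿inverseʳ _)) }

  +-nonneg : ∀ {x y} → 0# ≤ x → 0# ≤ y → 0# ≤ x + y
  +-nonneg {x} {y} 0≤x 0≤y =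
    ≤.trans 0≤y (subst (_≤ x + y) (+-identityˡ y) (+-mono-≤ 0# x y 0≤x))

  0≤1 : 0# ≤ 1#
  0≤1 with ≤.total 0# 1#
  ... | inj₁ 0≤1 = 0≤1
  ... | inj₂ 1≤0 =
    subst (0# ≤_) (solve 0 ((:- :1) :* (:- :1) := :1) refl) (*-nonneg _ _ 0≤-1 0≤-1)
    where
    0≤-1 : 0# ≤ - 1#
    0≤-1 = subst (0# ≤_) (+-identityˡ (- 1#)) (x≤y⇒0≤y-x 1≤0)

  0<1 : 0# < 1#
  0<1 = 0≤1 , 0≢1

  <-≤-trans : ∀ {x y z} → x < y → y ≤ z → x < z
  <-≤-trans (x≤y , x≢y) y≤z = ≤.trans x≤y y≤z , λ { refl → x≢y (≤.antisym x≤y y≤z) }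

  ⁻¹-inverseˡ : ∀ x → x ≢ 0# → x ⁻¹ * x ≡ 1#
  ⁻¹-inverseˡ x x≢0 = trans (*-comm (x ⁻¹) x) (⁻¹-inverse x x≢0)

  ⁻¹-pos : ∀ {x} → 0# < x → 0# < x ⁻¹
  ⁻¹-pos {x} (0≤x , 0≢x) = 0≤x⁻¹ , 0≢x⁻¹
    where
    xx⁻¹≡1 : x * x ⁻¹ ≡ 1#
    xx⁻¹≡1 = ⁻¹-inverse x (≢-sym 0≢x)

    0≢x⁻¹ : 0# ≢ x ⁻¹
    0≢x⁻¹ 0≡x⁻¹ = 0≢1 (trans (sym (zeroʳ x)) (trans (cong (x *_) 0≡x⁻¹) xx⁻¹≡1))

    0≤x⁻¹ : 0# ≤ x ⁻¹
    0≤x⁻¹ with ≤.total 0# (x ⁻¹)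
    ... | inj₁ 0≤x⁻¹ = 0≤x⁻¹
    ... | inj₂ x⁻¹≤0 = ⊥-elim (0≢1 (≤.antisym 0≤1 1≤0))
      where
      -1≡x[-x⁻¹] : 0# - 1# ≡ x * (0# - (x ⁻¹))
      -1≡x[-x⁻¹] = begin
        0# - 1#               ≡⟨ cong (λ a → 0# - a) xx⁻¹≡1 ⟨
        0# - (x * x ⁻¹)       ≡⟨ solve 2 (λ x y → :0 :- x :* y := x :* (:0 :- y)) refl x (x ⁻¹) ⟩
        x * (0# - (x ⁻¹))     ∎

      1≤0 : 1# ≤ 0#
      1≤0 = ≤-by-difference -1≡x[-x⁻¹] (*-nonneg _ _ 0≤x (x≤y⇒0≤y-x x⁻¹≤0))

  *-cancelˡ-nonneg : ∀ {α w} → 0# < α → 0# ≤ α * w → 0# ≤ w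
  *-cancelˡ-nonneg {α} {w} 0<α 0≤αw =
    subst (0# ≤_) α⁻¹αw≡w (*-nonneg _ _ (proj₁ (⁻¹-pos 0<α)) 0≤αw)
    where
    α⁻¹αw≡w : α ⁻¹ * (α * w) ≡ w
    α⁻¹αw≡w = begin
      α ⁻¹ * (α * w)  ≡⟨ *-assoc (α ⁻¹) α w ⟨
      (α ⁻¹ * α) * w  ≡⟨ cong (_* w) (⁻¹-inverseˡ α (≢-sym (proj₂ 0<α))) ⟩
      1# * w          ≡⟨ *-identityˡ w ⟩
      w               ∎

  ⁻¹+⁻¹≡1 : ∀ {s t} → s ≢ 0# → t ≢ 0# → s + t ≡ s * t → t ⁻¹ + s ⁻¹ ≡ 1#
  ⁻¹+⁻¹≡1 {s} {t} s≢0 t≢0 s+t≡st = begin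
    u + v                      ≡⟨ cong₂ _+_ (*-identityʳ u) (*-identityʳ v) ⟨
    u * 1# + v * 1#            ≡⟨ cong₂ (λ a b → u * a + v * b) sv≡1 tu≡1 ⟨
    u * (s * v) + v * (t * u)  ≡⟨ solve 4 (λ s t u v → u :* (s :* v) :+ v :* (t :* u)
                                                      := (u :* v) :* (s :+ t)) refl s t u v ⟩
    (u * v) * (s + t)          ≡⟨ cong ((u * v) *_) s+t≡st ⟩
    (u * v) * (s * t)          ≡⟨ solve 4 (λ s t u v → (u :* v) :* (s :* t)
                                                      := (t :* u) :* (s :* v)) refl s t u v ⟩
    (t * u) * (s * v)          ≡⟨ cong₂ _*_ tu≡1 sv≡1 ⟩
    1# * 1#                    ≡⟨ *-identityˡ 1# ⟩
    1#                         ∎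
    where
    u = t ⁻¹
    v = s ⁻¹
    tu≡1 = ⁻¹-inverse t t≢0
    sv≡1 = ⁻¹-inverse s s≢0

  conjugate : Carrier → Carrier
  conjugate t = (t - 1#) ⁻¹ * t

  [t-1]⁻¹-pos : ∀ {t} → 1# < t → 0# < (t - 1#) ⁻¹
  [t-1]⁻¹-pos 1<t = ⁻¹-pos (x<y⇒0<y-x 1<t)

  [t-1]⁻¹-inverse : ∀ {t} → 1# < t → (t - 1#) ⁻¹ * (t - 1#) ≡ 1#
  [t-1]⁻¹-inverse {t} 1<t = ⁻¹-inverseˡ (t - 1#) (≢-sym (proj₂ (x<y⇒0<y-x 1<t)))

  1<conjugate : ∀ {t} → 1# < t → 1# < conjugate t
  1<conjugate {t} 1<t = 0<y-x⇒x<y (subst (0# <_) (sym conjugate-1≡e) ([t-1]⁻¹-pos 1<t))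
    where
    e = (t - 1#) ⁻¹
    conjugate-1≡e : (e * t) - 1# ≡ e
    conjugate-1≡e = begin
      (e * t) - 1#                    ≡⟨ solve 2 (λ e t → e :* t :- :1
                                                         := e :+ :1 :* (e :* (t :- :1) :- :1))
                                           refl e t ⟩
      e + 1# * ((e * (t - 1#)) - 1#)  ≡⟨ +-vanish e 1# ([t-1]⁻¹-inverse 1<t) ⟩
      e                               ∎

  conjugate-inverse-sum : ∀ {t} → 1# < t → t ⁻¹ + conjugate t ⁻¹ ≡ 1#
  conjugate-inverse-sum {t} 1<t =
    ⁻¹+⁻¹≡1 (≢-sym (proj₂ (<-≤-trans 0<1 (proj₁ (1<conjugate 1<t)))))
            (≢-sym (proj₂ (<-≤-trans 0<1 (proj₁ 1<t))))
            s+t≡st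
    where
    e = (t - 1#) ⁻¹
    s+t≡st : e * t + t ≡ (e * t) * t
    s+t≡st = begin
      e * t + t
        ≡⟨ +-vanish (e * t + t) t ([t-1]⁻¹-inverse 1<t) ⟨
      e * t + t + t * ((e * (t - 1#)) - 1#)
        ≡⟨ solve 2 (λ e t → e :* t :+ t :+ t :* (e :* (t :- :1) :- :1) := (e :* t) :* t)
             refl e t ⟩
      (e * t) * t ∎

  mixing-weight : ∀ σ → ∃ λ α → 0# < α × 0# ≤ 1# - (α * (σ - 1#))
  mixing-weight σ with ≤.total σ 1#
  ... | inj₁ σ≤1 = 1# , 0<1 , subst (0# ≤_) 1+[1-σ]≡β (+-nonneg 0≤1 (x≤y⇒0≤y-x σ≤1))
    where
    1+[1-σ]≡β : 1# + (1# - σ) ≡ 1# - (1# * (σ - 1#))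
    1+[1-σ]≡β = solve 1 (λ σ → :1 :+ (:1 :- σ) := :1 :- :1 :* (σ :- :1)) refl σ
  ... | inj₂ 1≤σ = σ ⁻¹ , ⁻¹-pos 0<σ , subst (0# ≤_) σ⁻¹≡β (proj₁ (⁻¹-pos 0<σ))
    where
    0<σ : 0# < σ
    0<σ = <-≤-trans 0<1 1≤σ

    σ⁻¹≡β : σ ⁻¹ ≡ 1# - (σ ⁻¹ * (σ - 1#))
    σ⁻¹≡β = begin
      σ ⁻¹
        ≡⟨ +-vanish (σ ⁻¹) (- 1#) (⁻¹-inverseˡ σ (≢-sym (proj₂ 0<σ))) ⟨
      σ ⁻¹ + - 1# * ((σ ⁻¹ * σ) - 1#)
        ≡⟨ solve 2 (λ σ u → u :+ :- :1 :* (u :* σ :- :1) := :1 :- u :* (σ :- :1))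
             refl σ (σ ⁻¹) ⟩
      1# - (σ ⁻¹ * (σ - 1#)) ∎

  dot-scale : ∀ {k} (a x : Fin k → Carrier) α → dot a (λ j → α * x j) ≡ α * dot a x
  dot-scale {zero} a x α = sym (zeroʳ α)
  dot-scale {suc k} a x α = begin
    a zero * (α * x zero) + dot a′ (λ j → α * x′ j)
      ≡⟨ cong (a zero * (α * x zero) +_) (dot-scale a′ x′ α) ⟩
    a zero * (α * x zero) + α * dot a′ x′
      ≡⟨ solve 4 (λ a₀ x₀ α d → a₀ :* (α :* x₀) :+ α :* d := α :* (a₀ :* x₀ :+ d))
           refl (a zero) (x zero) α (dot a′ x′) ⟩
    α * (a zero * x zero + dot a′ x′) ∎
    where
    a′ = λ j → a (suc j)
    x′ = λ j → x (suc j)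

  dot-combination : ∀ {k} (a x y : Fin k → Carrier) α β →
                    dot a (λ j → α * x j + β * y j) ≡ α * dot a x + β * dot a y
  dot-combination {zero} a x y α β = solve 2 (λ α β → :0 := α :* :0 :+ β :* :0) refl α β
  dot-combination {suc k} a x y α β = begin
    a zero * (α * x zero + β * y zero) + dot a′ (λ j → α * x′ j + β * y′ j)
      ≡⟨ cong (a zero * (α * x zero + β * y zero) +_) (dot-combination a′ x′ y′ α β) ⟩
    a zero * (α * x zero + β * y zero) + (α * dot a′ x′ + β * dot a′ y′)
      ≡⟨ solve 7 (λ a₀ x₀ y₀ α β dx dy → a₀ :* (α :* x₀ :+ β :* y₀) :+ (α :* dx :+ β :* dy)
                                         := α :* (a₀ :* x₀ :+ dx) :+ β :* (a₀ :* y₀ :+ dy))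
           refl (a zero) (x zero) (y zero) α β (dot a′ x′) (dot a′ y′) ⟩
    α * (a zero * x zero + dot a′ x′) + β * (a zero * y zero + dot a′ y′) ∎
    where
    a′ = λ j → a (suc j)
    x′ = λ j → x (suc j)
    y′ = λ j → y (suc j)

  dot-complement : ∀ {k} q (c a y : Fin k → Carrier) →
                   dot (λ j → (q * c j) - a j) y ≡ (q * dot c y) - dot a y
  dot-complement {zero} q c a y = solve 1 (λ q → :0 := q :* :0 :- :0) refl q
  dot-complement {suc k} q c a y = begin
    ((q * c zero) - a zero) * y zero + dot (λ j → (q * c′ j) - a′ j) y′
      ≡⟨ cong (((q * c zero) - a zero) * y zero +_) (dot-complement q c′ a′ y′) ⟩
    ((q * c zero) - a zero) * y zero + ((q * dot c′ y′) - dot a′ y′)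
      ≡⟨ solve 6 (λ q c₀ a₀ y₀ dc da → (q :* c₀ :- a₀) :* y₀ :+ (q :* dc :- da)
                                       := q :* (c₀ :* y₀ :+ dc) :- (a₀ :* y₀ :+ da))
           refl q (c zero) (a zero) (y zero) (dot c′ y′) (dot a′ y′) ⟩
    (q * (c zero * y zero + dot c′ y′)) - (a zero * y zero + dot a′ y′) ∎
    where
    c′ = λ j → c (suc j)
    a′ = λ j → a (suc j)
    y′ = λ j → y (suc j)

  dot-complement-involutive : ∀ {k} q (c a y : Fin k → Carrier) →
                              dot a y ≡ (q * dot c y) - dot (λ j → (q * c j) - a j) y
  dot-complement-involutive q c a y = sym (begin
    (q * dot c y) - dot (λ j → (q * c j) - a j) y
      ≡⟨ cong (λ d → (q * dot c y) - d) (dot-complement q c a y) ⟩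
    (q * dot c y) - ((q * dot c y) - dot a y)
      ≡⟨ solve 2 (λ u d → u :- (u :- d) := d) refl (q * dot c y) (dot a y) ⟩
    dot a y ∎)

  combination-nonneg : ∀ {k} {x y : Fin k → Carrier} {α β} → 0# ≤ α → 0# ≤ β →
                       (∀ j → 0# ≤ x j) → (∀ j → 0# ≤ y j) → ∀ j → 0# ≤ α * x j + β * y j
  combination-nonneg 0≤α 0≤β x≥0 y≥0 j =
    +-nonneg (*-nonneg _ _ 0≤α (x≥0 j)) (*-nonneg _ _ 0≤β (y≥0 j))

  IsOpt-unique : ∀ R {s t} → IsOpt R s → IsOpt R t → s ≡ t
  IsOpt-unique (mkLP maximise m n c A b) {s} {t}
               ((x , x-feasible , cx≡s) , s-max) ((y , y-feasible , cy≡t) , t-max) =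
    ≤.antisym (subst (_≤ t) cx≡s (t-max x x-feasible)) (subst (_≤ s) cy≡t (s-max y y-feasible))
  IsOpt-unique (mkLP minimise m n c A b) {s} {t}
               ((x , x-feasible , cx≡s) , s-min) ((y , y-feasible , cy≡t) , t-min) =
    ≤.antisym (subst (s ≤_) cy≡t (s-min y y-feasible)) (subst (t ≤_) cx≡s (t-min x x-feasible))

  -- B is b cᵀ - A as far as values on vectors go.  The relation is symmetric in A and B,
  -- so the pair covers an LP of either sense together with its complement.
  module ComplementaryPair {m n : ℕ} (c : Fin n → Carrier) (A B : Fin m → Fin n → Carrier)
    (b : Fin m → Carrier)
    (complement-row : ∀ i y → dot (B i) y ≡ (b i * dot c y) - dot (A i) y) where

    maxLP minLP : LP
    maxLP = mkLP maximise m n c A b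
    minLP = mkLP minimise m n c B b

    scale-max⇒min : ∀ {x α} → Feasible maxLP x → 0# ≤ α → α * (dot c x - 1#) ≡ 1# →
                    Feasible minLP (λ j → α * x j)
    scale-max⇒min {x} {α} (x≥0 , Ax≤b) 0≤α α[cx-1]≡1 =
      (λ j → *-nonneg _ _ 0≤α (x≥0 j)) ,
      (λ i → ≤-by-difference (slack i) (*-nonneg _ _ 0≤α (x≤y⇒0≤y-x (Ax≤b i))))
      where
      slack : ∀ i → dot (B i) (λ j → α * x j) - b i ≡ α * (b i - dot (A i) x)
      slack i = begin
        dot (B i) (λ j → α * x j) - b i
          ≡⟨ cong (_- b i) (complement-row i _) ⟩
        ((b i * dot c (λ j → α * x j)) - dot (A i) (λ j → α * x j)) - b i
          ≡⟨ cong₂ (λ u v → ((b i * u) - v) - b i) (dot-scale c x α) (dot-scale (A i) x α) ⟩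
        ((b i * (α * dot c x)) - (α * dot (A i) x)) - b i
          ≡⟨ solve 4 (λ b α τ a → ((b :* (α :* τ)) :- (α :* a)) :- b
                                  := α :* (b :- a) :+ b :* (α :* (τ :- :1) :- :1))
               refl (b i) α (dot c x) (dot (A i) x) ⟩
        α * (b i - dot (A i) x) + b i * ((α * (dot c x - 1#)) - 1#)
          ≡⟨ +-vanish (α * (b i - dot (A i) x)) (b i) α[cx-1]≡1 ⟩
        α * (b i - dot (A i) x) ∎

    scale-min⇒max : ∀ {y α} → Feasible minLP y → 0# ≤ α → α * (dot c y - 1#) ≡ 1# →
                    Feasible maxLP (λ j → α * y j)
    scale-min⇒max {y} {α} (y≥0 , b≤By) 0≤α α[cy-1]≡1 =
      (λ j → *-nonneg _ _ 0≤α (y≥0 j)) ,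
      (λ i → ≤-by-difference (slack i) (*-nonneg _ _ 0≤α (x≤y⇒0≤y-x (b≤By i))))
      where
      slack : ∀ i → b i - dot (A i) (λ j → α * y j) ≡ α * (dot (B i) y - b i)
      slack i = begin
        b i - dot (A i) (λ j → α * y j)
          ≡⟨ cong (λ a → b i - a) (dot-scale (A i) y α) ⟩
        b i - (α * dot (A i) y)
          ≡⟨ +-vanish (b i - (α * dot (A i) y)) (b i) α[cy-1]≡1 ⟨
        b i - (α * dot (A i) y) + b i * ((α * (dot c y - 1#)) - 1#)
          ≡⟨ solve 4 (λ b α σ a → b :- α :* a :+ b :* (α :* (σ :- :1) :- :1)
                                  := α :* ((b :* σ :- a) :- b))
               refl (b i) α (dot c y) (dot (A i) y) ⟩
        α * (((b i * dot c y) - dot (A i) y) - b i)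
          ≡⟨ cong (λ u → α * (u - b i)) (complement-row i y) ⟨
        α * (dot (B i) y - b i) ∎

    mix-into-max : ∀ {x y α} → Feasible maxLP x → Feasible minLP y →
                   0# ≤ α → 0# ≤ 1# - (α * (dot c y - 1#)) →
                   Feasible maxLP (λ j → α * y j + (1# - (α * (dot c y - 1#))) * x j)
    mix-into-max {x} {y} {α} (x≥0 , Ax≤b) (y≥0 , b≤By) 0≤α 0≤β =
      combination-nonneg 0≤α 0≤β y≥0 x≥0 ,
      (λ i → ≤-by-difference (slack i)
               (+-nonneg (*-nonneg _ _ 0≤α (x≤y⇒0≤y-x (b≤By i)))
                         (*-nonneg _ _ 0≤β (x≤y⇒0≤y-x (Ax≤b i)))))
      where
      β = 1# - (α * (dot c y - 1#))
      slack : ∀ i → b i - dot (A i) (λ j → α * y j + β * x j) ≡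
                    α * (dot (B i) y - b i) + β * (b i - dot (A i) x)
      slack i = begin
        b i - dot (A i) (λ j → α * y j + β * x j)
          ≡⟨ cong (λ a → b i - a) (dot-combination (A i) y x α β) ⟩
        b i - (α * dot (A i) y + β * dot (A i) x)
          ≡⟨ solve 5 (λ b α σ ay ax →
                        b :- (α :* ay :+ (:1 :- α :* (σ :- :1)) :* ax)
                        := α :* ((b :* σ :- ay) :- b) :+ (:1 :- α :* (σ :- :1)) :* (b :- ax))
               refl (b i) α (dot c y) (dot (A i) y) (dot (A i) x) ⟩
        α * (((b i * dot c y) - dot (A i) y) - b i) + β * (b i - dot (A i) x)
          ≡⟨ cong (λ u → α * (u - b i) + β * (b i - dot (A i) x)) (complement-row i y) ⟨
        α * (dot (B i) y - b i) + β * (b i - dot (A i) x) ∎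

    mix-into-min : ∀ {x y α} → Feasible maxLP x → Feasible minLP y →
                   0# ≤ α → 0# ≤ 1# - (α * (dot c x - 1#)) →
                   Feasible minLP (λ j → α * x j + (1# - (α * (dot c x - 1#))) * y j)
    mix-into-min {x} {y} {α} (x≥0 , Ax≤b) (y≥0 , b≤By) 0≤α 0≤β =
      combination-nonneg 0≤α 0≤β x≥0 y≥0 ,
      (λ i → ≤-by-difference (slack i)
               (+-nonneg (*-nonneg _ _ 0≤α (x≤y⇒0≤y-x (Ax≤b i)))
                         (*-nonneg _ _ 0≤β (x≤y⇒0≤y-x (b≤By i)))))
      where
      β = 1# - (α * (dot c x - 1#))
      w = λ j → α * x j + β * y j
      slack : ∀ i → dot (B i) w - b i ≡ α * (b i - dot (A i) x) + β * (dot (B i) y - b i)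
      slack i = begin
        dot (B i) w - b i
          ≡⟨ cong (_- b i) (complement-row i w) ⟩
        ((b i * dot c w) - dot (A i) w) - b i
          ≡⟨ cong₂ (λ u v → ((b i * u) - v) - b i)
                   (dot-combination c x y α β) (dot-combination (A i) x y α β) ⟩
        ((b i * (α * dot c x + β * dot c y)) - (α * dot (A i) x + β * dot (A i) y)) - b i
          ≡⟨ solve 6 (λ b α τ s ax ay →
                        (b :* (α :* τ :+ (:1 :- α :* (τ :- :1)) :* s)
                          :- (α :* ax :+ (:1 :- α :* (τ :- :1)) :* ay)) :- b
                        := α :* (b :- ax) :+ (:1 :- α :* (τ :- :1)) :* ((b :* s :- ay) :- b))
               refl (b i) α (dot c x) (dot c y) (dot (A i) x) (dot (A i) y) ⟩
        α * (b i - dot (A i) x) + β * (((b i * dot c y) - dot (A i) y) - b i)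
          ≡⟨ cong (λ u → α * (b i - dot (A i) x) + β * (u - b i)) (complement-row i y) ⟨
        α * (b i - dot (A i) x) + β * (dot (B i) y - b i) ∎

    min-lower-bound : ∀ {t} → IsOpt maxLP t → 1# < t →
                      ∀ y → Feasible minLP y → conjugate t ≤ dot c y
    min-lower-bound {t} ((x , x-feasible , cx≡t) , t-max) 1<t y y-feasible
      with mixing-weight (dot c y)
    ... | α , 0<α , 0≤β =
      ≤-by-difference gap (*-nonneg _ _ (proj₁ ([t-1]⁻¹-pos 1<t)) 0≤σ[t-1]-t)
      where
      σ = dot c y
      e = (t - 1#) ⁻¹
      β = 1# - (α * (σ - 1#))
      z = λ j → α * y j + β * x j

      t-cz : t - dot c z ≡ α * ((σ * (t - 1#)) - t)
      t-cz = begin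
        t - dot c z                ≡⟨ cong (λ u → t - u) (dot-combination c y x α β) ⟩
        t - (α * σ + β * dot c x)  ≡⟨ cong (λ u → t - (α * σ + β * u)) cx≡t ⟩
        t - (α * σ + β * t)        ≡⟨ solve 3 (λ α σ t →
                                          t :- (α :* σ :+ (:1 :- α :* (σ :- :1)) :* t)
                                          := α :* (σ :* (t :- :1) :- t)) refl α σ t ⟩
        α * ((σ * (t - 1#)) - t)   ∎

      0≤σ[t-1]-t : 0# ≤ (σ * (t - 1#)) - t
      0≤σ[t-1]-t = *-cancelˡ-nonneg 0<α (subst (0# ≤_) t-cz
        (x≤y⇒0≤y-x (t-max z (mix-into-max x-feasible y-feasible (proj₁ 0<α) 0≤β))))

      gap : σ - (e * t) ≡ e * ((σ * (t - 1#)) - t)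
      gap = begin
        σ - (e * t)
          ≡⟨ +-vanish (σ - (e * t)) σ ([t-1]⁻¹-inverse 1<t) ⟨
        σ - (e * t) + σ * ((e * (t - 1#)) - 1#)
          ≡⟨ solve 3 (λ σ e t → σ :- e :* t :+ σ :* (e :* (t :- :1) :- :1)
                                := e :* (σ :* (t :- :1) :- t)) refl σ e t ⟩
        e * ((σ * (t - 1#)) - t) ∎

    max-upper-bound : ∀ {s} → IsOpt minLP s → 1# < s →
                      ∀ x → Feasible maxLP x → dot c x ≤ conjugate s
    max-upper-bound {s} ((y , y-feasible , cy≡s) , s-min) 1<s x x-feasible
      with mixing-weight (dot c x)
    ... | α , 0<α , 0≤β =
      ≤-by-difference gap (*-nonneg _ _ (proj₁ ([t-1]⁻¹-pos 1<s)) 0≤s-τ[s-1])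
      where
      τ = dot c x
      e = (s - 1#) ⁻¹
      β = 1# - (α * (τ - 1#))
      w = λ j → α * x j + β * y j

      cw-s : dot c w - s ≡ α * (s - (τ * (s - 1#)))
      cw-s = begin
        dot c w - s                ≡⟨ cong (_- s) (dot-combination c x y α β) ⟩
        (α * τ + β * dot c y) - s  ≡⟨ cong (λ u → (α * τ + β * u) - s) cy≡s ⟩
        (α * τ + β * s) - s        ≡⟨ solve 3 (λ α τ s →
                                          (α :* τ :+ (:1 :- α :* (τ :- :1)) :* s) :- s
                                          := α :* (s :- τ :* (s :- :1))) refl α τ s ⟩
        α * (s - (τ * (s - 1#)))   ∎

      0≤s-τ[s-1] : 0# ≤ s - (τ * (s - 1#))
      0≤s-τ[s-1] = *-cancelˡ-nonneg 0<α (subst (0# ≤_) cw-s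
        (x≤y⇒0≤y-x (s-min w (mix-into-min x-feasible y-feasible (proj₁ 0<α) 0≤β))))

      gap : (e * s) - τ ≡ e * (s - (τ * (s - 1#)))
      gap = begin
        (e * s) - τ
          ≡⟨ +-vanish ((e * s) - τ) (- τ) ([t-1]⁻¹-inverse 1<s) ⟨
        (e * s) - τ + - τ * ((e * (s - 1#)) - 1#)
          ≡⟨ solve 3 (λ τ e s → e :* s :- τ :+ :- τ :* (e :* (s :- :1) :- :1)
                                := e :* (s :- τ :* (s :- :1))) refl τ e s ⟩
        e * (s - (τ * (s - 1#))) ∎

    max⇒min : ∀ {t} → IsOpt maxLP t → 1# < t → IsOpt minLP (conjugate t)
    max⇒min {t} opt@((x , x-feasible , cx≡t) , _) 1<t =
      ((λ j → e * x j) , scale-max⇒min x-feasible (proj₁ ([t-1]⁻¹-pos 1<t)) e[cx-1]≡1 ,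
                         trans (dot-scale c x e) (cong (e *_) cx≡t)) ,
      min-lower-bound opt 1<t
      where
      e = (t - 1#) ⁻¹
      e[cx-1]≡1 : e * (dot c x - 1#) ≡ 1#
      e[cx-1]≡1 = trans (cong (λ u → e * (u - 1#)) cx≡t) ([t-1]⁻¹-inverse 1<t)

    min⇒max : ∀ {s} → IsOpt minLP s → 1# < s → IsOpt maxLP (conjugate s)
    min⇒max {s} opt@((y , y-feasible , cy≡s) , _) 1<s =
      ((λ j → e * y j) , scale-min⇒max y-feasible (proj₁ ([t-1]⁻¹-pos 1<s)) e[cy-1]≡1 ,
                         trans (dot-scale c y e) (cong (e *_) cy≡s)) ,
      max-upper-bound opt 1<s
      where
      e = (s - 1#) ⁻¹
      e[cy-1]≡1 : e * (dot c y - 1#) ≡ 1#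
      e[cy-1]≡1 = trans (cong (λ u → e * (u - 1#)) cy≡s) ([t-1]⁻¹-inverse 1<s)

  conjugate-optima : ∀ P Q → (∀ {t} → IsOpt P t → 1# < t → IsOpt Q (conjugate t)) →
                     (∀ {s} → IsOpt Q s → 1# < s → IsOpt P (conjugate s)) →
                     (OptGt1 P → OptGt1 Q) × (OptGt1 Q → OptGt1 P) ×
                     (∀ t s → IsOpt P t → IsOpt Q s → 1# < t → (t ⁻¹) + (s ⁻¹) ≡ 1#)
  conjugate-optima P Q P⇒Q Q⇒P = transfer P⇒Q , transfer Q⇒P , inverse-sum
    where
    transfer : ∀ {R S} → (∀ {t} → IsOpt R t → 1# < t → IsOpt S (conjugate t)) →
               OptGt1 R → OptGt1 S
    transfer R⇒S (t , opt , 1<t) = conjugate t , R⇒S opt 1<t , 1<conjugate 1<t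

    inverse-sum : ∀ t s → IsOpt P t → IsOpt Q s → 1# < t → (t ⁻¹) + (s ⁻¹) ≡ 1#
    inverse-sum t s opt-t opt-s 1<t = begin
      t ⁻¹ + s ⁻¹            ≡⟨ cong (λ u → t ⁻¹ + u ⁻¹) (IsOpt-unique Q opt-s (P⇒Q opt-t 1<t)) ⟩
      t ⁻¹ + conjugate t ⁻¹  ≡⟨ conjugate-inverse-sum 1<t ⟩
      1#                     ∎

theorem1 : (F : OrderedField) → (P : LinearPrograms.LP F) →
    let open OrderedField F
        open LinearPrograms F
    in (OptGt1 P → OptGt1 (complement P)) × (OptGt1 (complement P) → OptGt1 P) ×
       (∀ t s → IsOpt P t → IsOpt (complement P) s → 1# < t →
          (t ⁻¹) + (s ⁻¹) ≡ 1#)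
theorem1 F (LinearPrograms.mkLP LinearPrograms.maximise m n c A b) =
  conjugate-optima F maxLP minLP max⇒min min⇒max
  where
  open OrderedField F using (_*_; _-_)
  open ComplementaryPair F c A (λ i j → (b i * c j) - A i j) b
         (λ i → dot-complement F (b i) c (A i))
theorem1 F (LinearPrograms.mkLP LinearPrograms.minimise m n v M u) =
  conjugate-optima F minLP maxLP min⇒max max⇒min
  where
  open OrderedField F using (_*_; _-_)
  open ComplementaryPair F v (λ i j → (u i * v j) - M i j) M u
         (λ i → dot-complement-involutive F (u i) v (M i))
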